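{- For every Euclidean modal logic $\mathbf{L}$, $\mathtt{S}_{\mathbf{L}}$ is a closed subset of $\mathbf{N}^{+}\times\mathbf{N}^{ - }$.
   Context: A frame is a pair $(W,R)$ with $W$ non-empty and $R\subseteq W\times W$. Modal formulas are built from propositional variables, $\bot$, $\neg$, $\vee$, $\Box$ with Kripke semantics; validity means truth at every point under every valuation. A (normal) modal logic is a set of modal formulas containing all tautologies and all instances of $\Box(\varphi\to\psi)\to(\Box\varphi\to\Box\psi)$, closed under uniform substitution, modus ponens and necessitation; consistent means not containing $\bot$. A Euclidean modal logic is a consistent modal logic containing $\Diamond\varphi\to\Box\Diamond\varphi$ for all $\varphi$. $\mathbf{N}^{+}=\mathbb{N}\setminus\{0\}$, $\mathbf{N}^{ - }=\mathbb{N}\cup\{ -1\}$. For $m\in\mathbf{N}^{+}$, $n\in\mathbf{N}^{ - }$ the flower $\mathcal{F}_m^n$ is: if $n\in\mathbb{N}$, universe $\{0,\dots,m+n\}$ with relation $(\{0\}\times\{1,\dots,m\})\cup(\{1,\dots,m+n\}\times\{1,\dots,m+n\})$; if $n=-1$, universe $\{1,\dots,m\}$ with the universal relation. $\mathtt{S}_{\mathbf{L}}=\{(m,n)\in\mathbf{N}^{+}\times\mathbf{N}^{ - }:\mathcal{F}_m^n\text{ validates }\mathbf{L}\}$. On $\mathbf{N}^{+}\times\mathbf{N}^{ - }$, $(m,n)\ll(m',n')$ iff $m\leq m'$ and $n\leq n'$. A subset $\mathtt{S}\subseteq\mathbf{N}^{+}\times\mathbf{N}^{ - }$ is closed if whenever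 $(m,n)\in\mathtt{S}$ and $(m',n')\in\mathbf{N}^{+}\times\mathbf{N}^{ - }$ with $(m',n')\ll(m,n)$, then $(m',n')\in\mathtt{S}$. -}

module Defs where

open import Data.Nat using (ℕ; zero; suc; _+_; _≤_; _≤ᵇ_; _≡ᵇ_)
open import Data.Bool using (Bool; true; false; _∧_; _∨_; not)
open import Data.Fin using (Fin; toℕ)
open import Data.Product using (_×_)
open import Relation.Binary.PropositionalEquality using (_≡_)
open import Relation.Nullary using (¬_)

infixr 5 _∨ₘ_
data Fm : Set where
  var  : ℕ → Fm
  ⊥ₘ   : Fm
  ¬ₘ_  : Fm → Fm
  _∨ₘ_ : Fm → Fm → Fm
  □_   : Fm → Fm

infixr 4 _⇒_
_⇒_ : Fm → Fm → Fm
φ ⇒ ψ = (¬ₘ φ) ∨ₘ ψ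

◇_ : Fm → Fm
◇ φ = ¬ₘ (□ (¬ₘ φ))

subst : (ℕ → Fm) → Fm → Fm
subst σ (var p)   = σ p
subst σ ⊥ₘ        = ⊥ₘ
subst σ (¬ₘ φ)    = ¬ₘ (subst σ φ)
subst σ (φ ∨ₘ ψ)  = subst σ φ ∨ₘ subst σ ψ
subst σ (□ φ)     = □ (subst σ φ)

-- Tautologies: formulas true under every Boolean assignment in which
-- variables and boxed formulas are treated as propositional atoms.

tval : (Fm → Bool) → Fm → Bool
tval v (var p)   = v (var p)
tval v ⊥ₘ        = false
tval v (¬ₘ φ)    = not (tval v φ)
tval v (φ ∨ₘ ψ)  = tval v φ ∨ tval v ψ
tval v (□ φ)     = v (□ φ)

Tautology : Fm → Set
Tautology φ = ∀ (v : Fm → Bool) → tval v φ ≡ true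

record IsModalLogic (L : Fm → Set) : Set where
  field
    taut  : ∀ φ → Tautology φ → L φ
    axK   : ∀ φ ψ → L (□ (φ ⇒ ψ) ⇒ (□ φ ⇒ □ ψ))
    usubst : ∀ (σ : ℕ → Fm) φ → L φ → L (subst σ φ)
    mp    : ∀ φ ψ → L φ → L (φ ⇒ ψ) → L ψ
    nec   : ∀ φ → L φ → L (□ φ)

Consistent : (Fm → Set) → Set
Consistent L = ¬ L ⊥ₘ

record IsEuclideanLogic (L : Fm → Set) : Set where
  field
    isModalLogic : IsModalLogic L
    consistent   : Consistent L
    axEuc        : ∀ φ → L (◇ φ ⇒ □ (◇ φ))

-- Finite Kripke frames (universe Fin size, decidable relation).
-- Flowers are finite, so this suffices for S_L.

record Frame : Set where
  field
    size : ℕ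
    R    : Fin size → Fin size → Bool

allFin : (k : ℕ) → (Fin k → Bool) → Bool
allFin zero    f = true
allFin (suc k) f = f Fin.zero ∧ allFin k (λ i → f (Fin.suc i))

⟦_⟧ : (F : Frame) → Fm → (ℕ → Fin (Frame.size F) → Bool) → Fin (Frame.size F) → Bool
⟦ F ⟧ (var p)  V w = V p w
⟦ F ⟧ ⊥ₘ       V w = false
⟦ F ⟧ (¬ₘ φ)   V w = not (⟦ F ⟧ φ V w)
⟦ F ⟧ (φ ∨ₘ ψ) V w = ⟦ F ⟧ φ V w ∨ ⟦ F ⟧ ψ V w
⟦ F ⟧ (□ φ)    V w = allFin (Frame.size F) (λ u → not (Frame.R F w u) ∨ ⟦ F ⟧ φ V u)

Valid : Frame → Fm → Set
Valid F φ = ∀ (V : ℕ → Fin (Frame.size F) → Bool) (w : Fin (Frame.size F)) → ⟦ F ⟧ φ V w ≡ true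

Validates : Frame → (Fm → Set) → Set
Validates F L = ∀ φ → L φ → Valid F φ

data N⁻ : Set where
  minus1 : N⁻
  nat    : ℕ → N⁻

data _≤⁻_ : N⁻ → N⁻ → Set where
  -1≤ : ∀ {n} → minus1 ≤⁻ n
  n≤n : ∀ {a b} → a ≤ b → nat a ≤⁻ nat b

-- Flowers F_m^n (intended for m ≥ 1)
-- n = nat k : universe {0,…,m+k} (as Fin (suc (m + k)), point i ↦ toℕ i),
--   R = {0}×{1..m} ∪ {1..m+k}×{1..m+k}
-- n = -1    : universe {1,…,m} (as Fin m), universal relation

flower : ℕ → N⁻ → Frame
flower m (nat k) = record
  { size = suc (m + k)
  ; R    = λ i j → ((toℕ i ≡ᵇ 0) ∧ (1 ≤ᵇ toℕ j) ∧ (toℕ j ≤ᵇ m))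
                   ∨ ((1 ≤ᵇ toℕ i) ∧ (1 ≤ᵇ toℕ j)) }
flower m minus1 = record { size = m ; R = λ _ _ → true }

S : (Fm → Set) → ℕ → N⁻ → Set
S L m n = (1 ≤ m) × Validates (flower m n) L

Closed : (ℕ → N⁻ → Set) → Set
Closed P = ∀ m n m' n' → P m n → 1 ≤ m' → m' ≤ m → n' ≤⁻ n → P m' n'

{-# OPTIONS --safe #-}
-- Validity of a set of formulas passes to images under surjective bounded morphisms, and
-- F_m'^n' is such an image of F_m^n whenever (m',n') ≪ (m,n).  For n' ≥ 0, call m+1..m+n the stem
-- of F_m^n; fix the root and the petals 1..m', send the other petals to petal m', and send stem
-- point m+d to m'+min(d,n').  For n' = -1, retract every point onto m' of the petals: as every
-- point sees every petal, such a retraction is a bounded morphism onto the cluster F_m'^-1.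
module Submission where

open import Defs hiding (subst)
open import Data.Bool using (Bool; true; false; _∨_; not)
open import Data.Bool.Properties using (⇔→≡; ∨-identityʳ; T-≡)
open import Data.Fin using (Fin; zero; suc; toℕ; inject≤)
open import Data.Fin.Properties using (toℕ-injective; toℕ-inject≤; toℕ≤pred[n]; toℕ<n)
open import Data.Nat using (ℕ; zero; suc; _+_; _∸_; _⊓_; _≤_; _<_; z≤n; s≤s; _≤?_; pred)
open import Data.Nat.Properties
open import Data.Product using (_×_; _,_; ∃-syntax)
open import Function using (_∘_)
open import Function.Bundles using (mk⇔; Equivalence)
open import Relation.Binary.PropositionalEquality
  using (_≡_; refl; sym; trans; cong; cong₂; subst; subst₂; module ≡-Reasoning)
open import Relation.Nullary using (yes; no)

open Frame using (size; R)

allFin-sound : ∀ k (f : Fin k → Bool) → allFin k f ≡ true → ∀ i → f i ≡ true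
allFin-sound (suc k) f h i with f zero in f0
allFin-sound (suc k) f h zero    | true = f0
allFin-sound (suc k) f h (suc i) | true = allFin-sound k (f ∘ suc) h i

allFin-complete : ∀ k (f : Fin k → Bool) → (∀ i → f i ≡ true) → allFin k f ≡ true
allFin-complete zero    f h = refl
allFin-complete (suc k) f h rewrite h zero = allFin-complete k (f ∘ suc) (h ∘ suc)

⟦□⟧-elim : ∀ F φ V {w u} → ⟦ F ⟧ (□ φ) V w ≡ true → R F w u ≡ true → ⟦ F ⟧ φ V u ≡ true
⟦□⟧-elim F φ V {w} {u} h wRu =
  subst (λ b → not b ∨ ⟦ F ⟧ φ V u ≡ true) wRu (allFin-sound (size F) _ h u)

⟦□⟧-intro : ∀ F φ V {w} → (∀ u → R F w u ≡ true → ⟦ F ⟧ φ V u ≡ true) → ⟦ F ⟧ (□ φ) V w ≡ true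
⟦□⟧-intro F φ V {w} h = allFin-complete (size F) _ implication
  where
  implication : ∀ u → not (R F w u) ∨ ⟦ F ⟧ φ V u ≡ true
  implication u with R F w u in wRu
  ... | true  = h u wRu
  ... | false = refl

record _↠_ (F G : Frame) : Set where
  field
    to         : Fin (size F) → Fin (size G)
    forth      : ∀ {x y} → R F x y ≡ true → R G (to x) (to y) ≡ true
    back       : ∀ {x z} → R G (to x) z ≡ true → ∃[ y ] R F x y ≡ true × to y ≡ z
    surjective : ∀ z → ∃[ x ] to x ≡ z

module _ {F G : Frame} (f : F ↠ G) where
  open _↠_ f

  ⟦⟧-invariant : ∀ φ V x → ⟦ G ⟧ φ V (to x) ≡ ⟦ F ⟧ φ (λ p → V p ∘ to) x
  ⟦⟧-invariant (var p)  V x = refl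
  ⟦⟧-invariant ⊥ₘ       V x = refl
  ⟦⟧-invariant (¬ₘ φ)   V x = cong not (⟦⟧-invariant φ V x)
  ⟦⟧-invariant (φ ∨ₘ ψ) V x = cong₂ _∨_ (⟦⟧-invariant φ V x) (⟦⟧-invariant ψ V x)
  ⟦⟧-invariant (□ φ)    V x = ⇔→≡ (mk⇔
    (λ h → ⟦□⟧-intro F φ V′ (pullback h))
    (λ h → ⟦□⟧-intro G φ V (pushforward h)))
    where
    V′ : ℕ → Fin (size F) → Bool
    V′ p = V p ∘ to

    pullback : ⟦ G ⟧ (□ φ) V (to x) ≡ true → ∀ u → R F x u ≡ true → ⟦ F ⟧ φ V′ u ≡ true
    pullback h u xRu = trans (sym (⟦⟧-invariant φ V u)) (⟦□⟧-elim G φ V h (forth xRu))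

    pushforward : ⟦ F ⟧ (□ φ) V′ x ≡ true → ∀ z → R G (to x) z ≡ true → ⟦ G ⟧ φ V z ≡ true
    pushforward h z r with back r
    ... | y , xRy , refl = trans (⟦⟧-invariant φ V y) (⟦□⟧-elim F φ V′ h xRy)

  Validates-↠ : ∀ L → Validates F L → Validates G L
  Validates-↠ L valid φ Lφ V z with surjective z
  ... | x , refl = trans (⟦⟧-invariant φ V x) (valid φ Lφ _ x)

↠-cluster : ∀ F {n} (ι : Fin n → Fin (size F)) (r : Fin (size F) → Fin n)
          → (∀ i → r (ι i) ≡ i) → (∀ x i → R F x (ι i) ≡ true) → F ↠ flower n minus1
↠-cluster F ι r r∘ι seen = record
  { to         = r
  ; forth      = λ _ → refl
  ; back       = λ {x} {z} _ → ι z , seen x z , r∘ι z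
  ; surjective = λ z → ι z , r∘ι z
  }

clamp : ∀ a → ℕ → Fin (suc a)
clamp zero    _       = zero
clamp (suc a) zero    = zero
clamp (suc a) (suc i) = suc (clamp a i)

toℕ-clamp : ∀ {a i} → i ≤ a → toℕ (clamp a i) ≡ i
toℕ-clamp {zero}  z≤n       = refl
toℕ-clamp {suc a} z≤n       = refl
toℕ-clamp {suc a} (s≤s i≤a) = cong suc (toℕ-clamp i≤a)

clamp-toℕ : ∀ {a} (i : Fin (suc a)) → clamp a (toℕ i) ≡ i
clamp-toℕ i = toℕ-injective (toℕ-clamp (toℕ≤pred[n] i))

-- The relation of F_m^n (n ≥ 0) on point indices, 0 being the root; it does not depend on n.
data Sees (m : ℕ) : ℕ → ℕ → Set where
  root→petal : ∀ {j} → j < m → Sees m 0 (suc j)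
  cluster    : ∀ {i j} → Sees m (suc i) (suc j)

petal-seen : ∀ {m} i {j} → j < m → Sees m i (suc j)
petal-seen zero    j<m = root→petal j<m
petal-seen (suc i) _   = cluster

module _ (m k : ℕ) {x y : Fin (suc (m + k))} where

  R⇒Sees : R (flower m (nat k)) x y ≡ true → Sees m (toℕ x) (toℕ y)
  R⇒Sees r with toℕ x | toℕ y
  ... | zero  | suc j = root→petal (≤ᵇ⇒≤ (suc j) m (Equivalence.from T-≡ (trans (sym (∨-identityʳ _)) r)))
  ... | suc i | suc j = cluster

  Sees⇒R : Sees m (toℕ x) (toℕ y) → R (flower m (nat k)) x y ≡ true
  Sees⇒R s with toℕ x | toℕ y
  Sees⇒R (root→petal j<m) | zero  | suc j = trans (∨-identityʳ _) (Equivalence.to T-≡ (≤⇒≤ᵇ j<m))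
  Sees⇒R cluster          | suc i | suc j = refl

module _ {m k m′ k′ : ℕ} (g : ℕ → ℕ) (g-≤ : ∀ j → g j ≤ m′ + k′)
  (g-forth : ∀ {i j} → Sees m i j → Sees m′ (g i) (g j))
  (g-back  : ∀ {i z} → z ≤ m′ + k′ → Sees m′ (g i) z → ∃[ y ] y ≤ m + k × Sees m i y × g y ≡ z)
  (g-onto  : ∀ {z} → z ≤ m′ + k′ → ∃[ y ] y ≤ m + k × g y ≡ z)
  where

  flower-↠-fromℕ : flower m (nat k) ↠ flower m′ (nat k′)
  flower-↠-fromℕ = record { to = to ; forth = forth ; back = back ; surjective = surjective }
    where
    to : Fin (suc (m + k)) → Fin (suc (m′ + k′))
    to x = clamp (m′ + k′) (g (toℕ x))

    toℕ-to : ∀ x → toℕ (to x) ≡ g (toℕ x)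
    toℕ-to x = toℕ-clamp (g-≤ (toℕ x))

    to-clamp : ∀ {y} z → y ≤ m + k → g y ≡ toℕ z → to (clamp (m + k) y) ≡ z
    to-clamp z y≤ gy≡z = toℕ-injective (trans (toℕ-to _) (trans (cong g (toℕ-clamp y≤)) gy≡z))

    forth : ∀ {x y} → R (flower m (nat k)) x y ≡ true → R (flower m′ (nat k′)) (to x) (to y) ≡ true
    forth {x} {y} xRy =
      Sees⇒R m′ k′ (subst₂ (Sees m′) (sym (toℕ-to x)) (sym (toℕ-to y)) (g-forth (R⇒Sees m k xRy)))

    back : ∀ {x z} → R (flower m′ (nat k′)) (to x) z ≡ true
         → ∃[ y ] R (flower m (nat k)) x y ≡ true × to y ≡ z
    back {x} {z} r
      with g-back (toℕ≤pred[n] z) (subst (λ t → Sees m′ t (toℕ z)) (toℕ-to x) (R⇒Sees m′ k′ r))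
    ... | y , y≤ , xSy , gy≡z = clamp (m + k) y
        , Sees⇒R m k (subst (Sees m (toℕ x)) (sym (toℕ-clamp y≤)) xSy)
        , to-clamp z y≤ gy≡z

    surjective : ∀ z → ∃[ x ] to x ≡ z
    surjective z with g-onto (toℕ≤pred[n] z)
    ... | y , y≤ , gy≡z = clamp (m + k) y , to-clamp z y≤ gy≡z

module Shrink {a b k k′ : ℕ} (a≤b : a ≤ b) (k′≤k : k′ ≤ k) where

  shrink : ℕ → ℕ
  shrink j = j ⊓ suc a + (j ∸ suc b) ⊓ k′

  shrink-≤ : ∀ j → shrink j ≤ suc a + k′
  shrink-≤ j = +-mono-≤ (m⊓n≤n j (suc a)) (m⊓n≤n (j ∸ suc b) k′)

  shrink-petal : ∀ {j} → j ≤ suc b → shrink j ≡ j ⊓ suc a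
  shrink-petal {j} j≤ = begin
    j ⊓ suc a + (j ∸ suc b) ⊓ k′  ≡⟨ cong (λ t → j ⊓ suc a + t ⊓ k′) (m≤n⇒m∸n≡0 j≤) ⟩
    j ⊓ suc a + 0                 ≡⟨ +-identityʳ _ ⟩
    j ⊓ suc a                     ∎
    where open ≡-Reasoning

  shrink-fixes-petals : ∀ {j} → j ≤ suc a → shrink j ≡ j
  shrink-fixes-petals j≤ = trans (shrink-petal (≤-trans j≤ (s≤s a≤b))) (m≤n⇒m⊓n≡m j≤)

  shrink-stem : ∀ {d} → d ≤ k′ → shrink (suc b + d) ≡ suc a + d
  shrink-stem {d} d≤k′ = cong₂ _+_
    (m≥n⇒m⊓n≡n (s≤s (≤-trans a≤b (m≤m+n b d))))
    (trans (cong (_⊓ k′) (m+n∸m≡n b d)) (m≤n⇒m⊓n≡m d≤k′))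

  shrink-onto-cluster : ∀ {z} → z ≤ a + k′ → ∃[ y ] y ≤ b + k × shrink (suc y) ≡ suc z
  shrink-onto-cluster {z} z≤ with z ≤? a
  ... | yes z≤a = z , ≤-trans z≤a (≤-trans a≤b (m≤m+n b k)) , shrink-fixes-petals (s≤s z≤a)
  ... | no  z≰a = b + (z ∸ a)
      , +-monoʳ-≤ b (≤-trans d≤k′ k′≤k)
      , trans (shrink-stem d≤k′) (cong suc (m+[n∸m]≡n (≰⇒≥ z≰a)))
    where
    d≤k′ : z ∸ a ≤ k′
    d≤k′ = m≤n+o⇒m∸n≤o z a z≤

  shrink-forth : ∀ {i j} → Sees (suc b) i j → Sees (suc a) (shrink i) (shrink j)
  shrink-forth (root→petal {j} j<m) rewrite shrink-petal j<m = root→petal (s≤s (m⊓n≤n j a))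
  shrink-forth cluster = cluster

  shrink-back : ∀ {i z} → z ≤ suc a + k′ → Sees (suc a) (shrink i) z
              → ∃[ y ] y ≤ suc b + k × Sees (suc b) i y × shrink y ≡ z
  shrink-back {zero} _ (root→petal {j} j<m′) = suc j
    , ≤-trans j<m′ (s≤s (≤-trans a≤b (m≤m+n b k)))
    , root→petal (≤-trans j<m′ (s≤s a≤b))
    , shrink-fixes-petals j<m′
  shrink-back {suc i} (s≤s z≤) cluster with shrink-onto-cluster z≤
  ... | y , y≤ , eq = suc y , s≤s y≤ , cluster , eq

  shrink-onto : ∀ {z} → z ≤ suc a + k′ → ∃[ y ] y ≤ suc b + k × shrink y ≡ z
  shrink-onto {zero}  _        = zero , z≤n , refl
  shrink-onto {suc z} (s≤s z≤) with shrink-onto-cluster z≤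
  ... | y , y≤ , eq = suc y , s≤s y≤ , eq

flower-↠-flower : ∀ {a b k k′} → a ≤ b → k′ ≤ k → flower (suc b) (nat k) ↠ flower (suc a) (nat k′)
flower-↠-flower a≤b k′≤k = flower-↠-fromℕ shrink shrink-≤ shrink-forth shrink-back shrink-onto
  where open Shrink a≤b k′≤k

cluster-↠-cluster : ∀ {a b} → a ≤ b → flower (suc b) minus1 ↠ flower (suc a) minus1
cluster-↠-cluster {a} {b} a≤b = ↠-cluster (flower (suc b) minus1) ι (clamp a ∘ toℕ) r∘ι (λ _ _ → refl)
  where
  ι : Fin (suc a) → Fin (suc b)
  ι i = inject≤ i (s≤s a≤b)

  r∘ι : ∀ i → clamp a (toℕ (ι i)) ≡ i
  r∘ι i = trans (cong (clamp a) (toℕ-inject≤ i _)) (clamp-toℕ i)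

flower-↠-cluster : ∀ {a b k} → a ≤ b → flower (suc b) (nat k) ↠ flower (suc a) minus1
flower-↠-cluster {a} {b} {k} a≤b =
  ↠-cluster (flower (suc b) (nat k)) ι (clamp a ∘ pred ∘ toℕ) r∘ι seen
  where
  ι : Fin (suc a) → Fin (suc (suc b + k))
  ι i = suc (inject≤ i (s≤s (≤-trans a≤b (m≤m+n b k))))

  r∘ι : ∀ i → clamp a (pred (toℕ (ι i))) ≡ i
  r∘ι i = trans (cong (clamp a) (toℕ-inject≤ i _)) (clamp-toℕ i)

  seen : ∀ x i → R (flower (suc b) (nat k)) x (ι i) ≡ true
  seen x i = Sees⇒R (suc b) k (petal-seen (toℕ x) petal<)
    where
    petal< : toℕ (inject≤ i _) < suc b
    petal< = subst (_< suc b) (sym (toℕ-inject≤ i _)) (≤-trans (toℕ<n i) (s≤s a≤b))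

flower-↠ : ∀ {m m′ n n′} → 1 ≤ m′ → m′ ≤ m → n′ ≤⁻ n → flower m n ↠ flower m′ n′
flower-↠ (s≤s z≤n) (s≤s a≤b) (-1≤ {minus1}) = cluster-↠-cluster a≤b
flower-↠ (s≤s z≤n) (s≤s a≤b) (-1≤ {nat k})  = flower-↠-cluster a≤b
flower-↠ (s≤s z≤n) (s≤s a≤b) (n≤n k′≤k)     = flower-↠-flower a≤b k′≤k

lemma35 : ∀ (L : Fm → Set) → IsEuclideanLogic L → Closed (S L)
lemma35 L _ m n m′ n′ (_ , valid) 1≤m′ m′≤m n′≤n =
  1≤m′ , Validates-↠ (flower-↠ 1≤m′ m′≤m n′≤n) L valid
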